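{- Let $D$ be a finite irreflexive binary relational system. Then $D$ is homomorphism-homogeneous if and only if $D$ is isomorphic to one of the following: (1) $k\cdot K_n$ for some $k,n\ge 1$; (2) $k\cdot C_3$ for some $k\ge 1$.
   Context: A binary relational system (digraph) is $D=(V,E)$ with $E\subseteq V^2$; it is irreflexive if $(x,x)\notin E$ for all $x$. A homomorphism $f:D_1\to D_2$ is a vertex map with $(x,y)\in E_1\Rightarrow (f(x),f(y))\in E_2$; an endomorphism is a homomorphism $D\to D$; isomorphisms are bijections preserving edges in both directions. For $\emptyset\neq W\subseteq V$, $D[W]=(W,E\cap W^2)$. $D$ is homomorphism-homogeneous if every homomorphism between finite induced subdigraphs of $D$ extends to an endomorphism of $D$. $K_n$ is the complete irreflexive graph on $n$ vertices (edges $(x,y)$ for all $x\neq y$). $C_3$ is the oriented cycle with vertices $1,2,3$ and edges $1\to2\to3\to1$ only. $k\cdot D$ denotes the disjoint union of $k$ copies of $D$. -}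

module Defs where

open import Data.Nat using (ℕ; suc)
open import Data.Bool using (Bool; true; false; T; _∧_; not)
open import Data.Fin using (Fin; zero; suc; _≟_)
open import Data.Fin.Subset using (Subset; _∈_; Nonempty)
open import Data.Product using (Σ; _×_; _,_; proj₁; proj₂)
open import Relation.Nullary.Decidable using (⌊_⌋)
open import Relation.Binary.PropositionalEquality using (_≡_)
open import Function.Bundles using (_↔_; Inverse)
open import Level using (0ℓ)

record Digraph : Set₁ where
  field
    V : Set
    E : V → V → Bool
open Digraph public

mkFin : (m : ℕ) → (Fin m → Fin m → Bool) → Digraph
mkFin m E = record { V = Fin m ; E = E }

Irreflexive : Digraph → Set
Irreflexive D = ∀ x → E D x x ≡ false

IsHom : (D₁ D₂ : Digraph) → (V D₁ → V D₂) → Set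
IsHom D₁ D₂ f = ∀ x y → T (E D₁ x y) → T (E D₂ (f x) (f y))

_≅_ : Digraph → Digraph → Set
D₁ ≅ D₂ = Σ (V D₁ ↔ V D₂) λ φ →
  ∀ x y → E D₁ x y ≡ E D₂ (Inverse.to φ x) (Inverse.to φ y)

Induced : (m : ℕ) → (Fin m → Fin m → Bool) → Subset m → Digraph
Induced m E W = record { V = Σ (Fin m) (λ x → x ∈ W)
                       ; E = λ x y → E (proj₁ x) (proj₁ y) }

HomHomogeneous : (m : ℕ) → (Fin m → Fin m → Bool) → Set
HomHomogeneous m E =
  ∀ (W₁ W₂ : Subset m) → Nonempty W₁ → Nonempty W₂ →
  (f : V (Induced m E W₁) → V (Induced m E W₂)) →
  IsHom (Induced m E W₁) (Induced m E W₂) f →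
  Σ (Fin m → Fin m) λ g →
    IsHom (mkFin m E) (mkFin m E) g ×
    (∀ x (p : x ∈ W₁) → g x ≡ proj₁ (f (x , p)))

kK : ℕ → ℕ → Digraph
kK k n = record { V = Fin k × Fin n
                ; E = λ x y → ⌊ proj₁ x ≟ proj₁ y ⌋ ∧ not ⌊ proj₂ x ≟ proj₂ y ⌋ }

-- successor on the vertices of C_3 (vertices 1,2,3 as 0,1,2): 1→2→3→1
next3 : Fin 3 → Fin 3
next3 zero = suc zero
next3 (suc zero) = suc (suc zero)
next3 (suc (suc zero)) = zero

kC3 : ℕ → Digraph
kC3 k = record { V = Fin k × Fin 3
               ; E = λ x y → ⌊ proj₁ x ≟ proj₁ y ⌋ ∧ ⌊ proj₂ y ≟ next3 (proj₂ x) ⌋ }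

-- If D has a 2-cycle, grow a clique until no out-neighbour of a member lies outside it. Such a
-- closed clique is as large as any clique (an endomorphism sending a clique's first vertex into
-- it maps the whole clique injectively into it), so its images under endomorphisms are closed
-- cliques through every vertex; they are the components, and D ≅ k · Kₙ.
--
-- If D is oriented, the ends of a path x → y → z are adjacent (otherwise send x and z to x, and
-- the image of y lies on a 2-cycle with x), and homogeneity passes to out- and in-neighbourhoods
-- (extend partial maps by fixing the centre). Induction on their size rules out transitive
-- triangles, so every vertex has a unique out-neighbour and every path closes into a 3-cycle:
-- D ≅ k · C₃. Without edges, D ≅ k · K₁.
--
-- Conversely, a partial homomorphism of k · Kₙ or k · C₃ extends copy by copy, extending a
-- partial injection of Kₙ to a permutation, resp. a partial map of C₃ to a rotation.

module Submission where

open import Defs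
open import Data.Nat using (ℕ; zero; suc; _+_; _≥_; _≤_; _<_; z≤n; s≤s)
open import Data.Bool using (Bool; true; false; T; _∧_; _∨_; not)
open import Data.Bool.Properties using (T-≡; T-∧; T-∨; T?; ¬-not)
open import Data.Unit using (tt)
open import Data.Empty using (⊥; ⊥-elim)
open import Data.Fin using (Fin; zero; suc; _≟_)
open import Data.Fin.Properties using (any?; all?; toℕ<n; injective⇒≤)
open import Data.Fin.Subset using (_∈_; ⊤; ∣_∣)
open import Data.Fin.Subset.Properties using (∈⊤; p⊂q⇒∣p∣<∣q∣; _∈?_)
open import Data.Fin.Permutation.Components using (transpose; transpose-inverse)
open import Data.Product using (Σ; _×_; _,_; proj₁; proj₂; ∃)
open import Data.Sum using (_⊎_; inj₁; inj₂)
open import Data.List using (List; allFin) renaming ([] to []ᴸ; _∷_ to _∷ᴸ_)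
open import Data.List.Membership.Propositional using () renaming (_∈_ to _∈ᴸ_)
open import Data.List.Membership.Propositional.Properties using (∈-allFin)
open import Data.List.Relation.Unary.Any using (here; there)
open import Data.Vec using (tabulate)
open import Data.Vec.Properties using (lookup⇒[]=; []=⇒lookup; lookup∘tabulate)
open import Data.Vec.Properties.WithK using ([]=-irrelevant)
open import Data.Vec.Functional using (updateAt; []; _∷_)
open import Data.Vec.Functional.Properties using (updateAt-updates; updateAt-minimal)
open import Function using (_∘_; const; id)
open import Function.Bundles using (_⇔_; mk⇔; Equivalence; Inverse; mk↔ₛ′)
open import Function.Definitions using (Injective)
open import Relation.Nullary using (¬_; Dec; yes; no; contradiction)
open import Relation.Nullary.Decidable
  using ( ⌊_⌋; toWitness; fromWitness; toWitnessFalse; fromWitnessFalse; dec-true; dec-false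
        ; _⊎-dec_; _→-dec_; _×-dec_; ¬?; decidable-stable)
open import Data.Nat.Induction using (<-wellFounded)
open import Data.Nat.Properties using (≤-trans; <-irrefl; +-suc; +-identityʳ; ≤-reflexive; m≤n+m)
open import Induction.WellFounded using (module All)
import Relation.Binary.Construct.On as On
open import Relation.Binary.PropositionalEquality
  using (_≡_; _≢_; refl; sym; trans; cong; cong₂; subst; subst₂; module ≡-Reasoning)

∈-tabulate⁺ : ∀ {m} {P : Fin m → Bool} {x} → T (P x) → x ∈ tabulate P
∈-tabulate⁺ {P = P} {x} Px = lookup⇒[]= x (tabulate P) (trans (lookup∘tabulate P x) (Equivalence.to T-≡ Px))

∈-tabulate⁻ : ∀ {m} {P : Fin m → Bool} {x} → x ∈ tabulate P → T (P x)
∈-tabulate⁻ {P = P} {x} x∈P = Equivalence.from T-≡ (trans (sym (lookup∘tabulate P x)) ([]=⇒lookup x∈P))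

¬T⇒≡false : ∀ {b} → ¬ T b → b ≡ false
¬T⇒≡false ¬b = ¬-not (¬b ∘ Equivalence.from T-≡)

next3-injective : Injective _≡_ _≡_ next3
next3-injective {a} {b} = toWitness {a? = all? λ a → all? λ b → (next3 a ≟ next3 b) →-dec (a ≟ b)} tt a b

next3-trichotomy : ∀ a b → a ≡ b ⊎ b ≡ next3 a ⊎ a ≡ next3 b
next3-trichotomy =
  toWitness {a? = all? λ a → all? λ b → (a ≟ b) ⊎-dec ((b ≟ next3 a) ⊎-dec (a ≟ next3 b))} tt

module Relative {m : ℕ} (E : Fin m → Fin m → Bool) (irr : Irreflexive (mkFin m E)) where

  infix 4 _⟶_ _⊆_

  _⟶_ : Fin m → Fin m → Set
  x ⟶ y = T (E x y)

  ⟶-irrefl : ∀ {x} → ¬ x ⟶ x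
  ⟶-irrefl {x} = subst T (irr x)

  ⟶⇒≢ : ∀ {x y} → x ⟶ y → x ≢ y
  ⟶⇒≢ x⟶x refl = ⟶-irrefl x⟶x

  _⊆_ : (Fin m → Bool) → (Fin m → Bool) → Set
  P ⊆ U = ∀ x → T (P x) → T (U x)

  MapsInto : (Fin m → Fin m) → (Fin m → Bool) → (Fin m → Bool) → Set
  MapsInto h P U = ∀ x → T (P x) → T (U (h x))

  HomOn : (Fin m → Bool) → (Fin m → Fin m) → Set
  HomOn P h = ∀ x y → T (P x) → T (P y) → x ⟶ y → h x ⟶ h y

  record Endo (U : Fin m → Bool) : Set where
    field
      map  : Fin m → Fin m
      into : MapsInto map U U
      hom  : HomOn U map

  open Endo public

  -- Homomorphism-homogeneity of the induced subdigraph on U, with maps written as total functions.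
  HomHomogeneousOn : (Fin m → Bool) → Set
  HomHomogeneousOn U = ∀ P → P ⊆ U → ∃ (λ x → T (P x)) →
    (h : Fin m → Fin m) → MapsInto h P U → HomOn P h →
    Σ (Endo U) λ g → ∀ x → T (P x) → map g x ≡ h x

  everything : Fin m → Bool
  everything _ = true

  homHomogeneous⇒On-everything : HomHomogeneous m E → HomHomogeneousOn everything
  homHomogeneous⇒On-everything hh P _ (x₀ , Px₀) h _ h-hom = g , agrees
    where
    extension = hh (tabulate P) ⊤ (x₀ , ∈-tabulate⁺ Px₀) (x₀ , ∈⊤) (λ x → h (proj₁ x) , ∈⊤)
      (λ x y → h-hom (proj₁ x) (proj₁ y) (∈-tabulate⁻ (proj₂ x)) (∈-tabulate⁻ (proj₂ y)))
    g : Endo everything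
    g = record
      { map = proj₁ extension
      ; into = λ _ _ → tt
      ; hom = λ x y _ _ → proj₁ (proj₂ extension) x y
      }
    agrees : ∀ x → T (P x) → map g x ≡ h x
    agrees x Px = proj₂ (proj₂ extension) x (∈-tabulate⁺ Px)

  _≼[_]_ : Fin m → Fin m → Fin m → Set
  x ≼[ s ] y = (s ⟶ x → s ⟶ y) × (x ⟶ s → y ⟶ s)

  edge-via : ∀ {U} (g : Endo U) {x y a b} → T (U x) → T (U y) →
    map g x ≡ a → map g y ≡ b → x ⟶ y → a ⟶ b
  edge-via g Ux Uy refl refl = hom g _ _ Ux Uy

  module _ {U : Fin m → Bool} (hh : HomHomogeneousOn U) where

    extend-points : ∀ {k} (pt img : Fin (suc k) → Fin m) → Injective _≡_ _≡_ pt →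
      (∀ i → T (U (pt i))) → (∀ i → T (U (img i))) → (∀ i j → pt i ⟶ pt j → img i ⟶ img j) →
      Σ (Endo U) λ g → ∀ i → map g (pt i) ≡ img i
    extend-points pt img pt-inj pt∈U img∈U pt-hom = g , λ i → trans (agrees (pt i) (isPoint-pt i)) (h-pt i)
      where
      isPoint : Fin m → Bool
      isPoint x = ⌊ any? (λ i → pt i ≟ x) ⌋
      isPoint-pt : ∀ i → T (isPoint (pt i))
      isPoint-pt i = fromWitness (i , refl)
      h : Fin m → Fin m
      h x with any? (λ i → pt i ≟ x)
      ... | yes (i , _) = img i
      ... | no _ = x
      h-pt : ∀ i → h (pt i) ≡ img i
      h-pt i with any? (λ j → pt j ≟ pt i)
      ... | yes (j , ptj≡pti) = cong img (pt-inj ptj≡pti)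
      ... | no ¬pt = contradiction (i , refl) ¬pt
      points⊆U : isPoint ⊆ U
      points⊆U x t with toWitness t
      ... | i , refl = pt∈U i
      h-into : MapsInto h isPoint U
      h-into x t with toWitness t
      ... | i , refl = subst (T ∘ U) (sym (h-pt i)) (img∈U i)
      h-hom : HomOn isPoint h
      h-hom x y tx ty x⟶y with toWitness tx | toWitness ty
      ... | i , refl | j , refl = subst₂ _⟶_ (sym (h-pt i)) (sym (h-pt j)) (pt-hom i j x⟶y)
      extension = hh isPoint points⊆U (pt zero , isPoint-pt zero) h h-into h-hom
      g = proj₁ extension
      agrees = proj₂ extension

    -- A set N of vertices all related alike to a fixed s ∈ U inherits homogeneity: extend by s ↦ s.
    homHomogeneousOn-alike : ∀ {s} N → T (U s) → N ⊆ U → ¬ T (N s) →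
      (∀ x y → T (N x) → T (N y) → x ≼[ s ] y) →
      (∀ x y → T (N x) → T (U y) → x ≼[ s ] y → T (N y)) → HomHomogeneousOn N
    homHomogeneousOn-alike {s} N Us N⊆U s∉N alike closed P P⊆N (x₀ , Px₀) h h-into h-hom =
      g , λ x Px → trans (proj₂ extension x (inj₁∨ Px)) (h′-P Px)
      where
      P′ : Fin m → Bool
      P′ x = P x ∨ ⌊ x ≟ s ⌋
      inj₁∨ : ∀ {x} → T (P x) → T (P′ x)
      inj₁∨ Px = Equivalence.from T-∨ (inj₁ Px)
      P′-s : T (P′ s)
      P′-s = Equivalence.from (T-∨ {P s}) (inj₂ (fromWitness refl))
      cases : ∀ {x} → T (P′ x) → T (P x) ⊎ x ≡ s
      cases t with Equivalence.to T-∨ t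
      ... | inj₁ Px = inj₁ Px
      ... | inj₂ x≡s = inj₂ (toWitness x≡s)
      h′ : Fin m → Fin m
      h′ = updateAt h s (const s)
      h′-s : h′ s ≡ s
      h′-s = updateAt-updates s h
      h′-P : ∀ {x} → T (P x) → h′ x ≡ h x
      h′-P {x} Px = updateAt-minimal x s h λ { refl → s∉N (P⊆N s Px) }
      P′⊆U : P′ ⊆ U
      P′⊆U x t with cases t
      ... | inj₁ Px = N⊆U x (P⊆N x Px)
      ... | inj₂ refl = Us
      h′-into : MapsInto h′ P′ U
      h′-into x t with cases t
      ... | inj₁ Px = subst (T ∘ U) (sym (h′-P Px)) (N⊆U _ (h-into x Px))
      ... | inj₂ refl = subst (T ∘ U) (sym h′-s) Us
      x≼hx : ∀ {x} → T (P x) → x ≼[ s ] h x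
      x≼hx {x} Px = alike x (h x) (P⊆N x Px) (h-into x Px)
      h′-hom : HomOn P′ h′
      h′-hom x y tx ty x⟶y with cases tx | cases ty
      ... | inj₁ Px | inj₁ Py = subst₂ _⟶_ (sym (h′-P Px)) (sym (h′-P Py)) (h-hom x y Px Py x⟶y)
      ... | inj₁ Px | inj₂ refl = subst₂ _⟶_ (sym (h′-P Px)) (sym h′-s) (proj₂ (x≼hx Px) x⟶y)
      ... | inj₂ refl | inj₁ Py = subst₂ _⟶_ (sym h′-s) (sym (h′-P Py)) (proj₁ (x≼hx Py) x⟶y)
      ... | inj₂ refl | inj₂ refl = contradiction x⟶y ⟶-irrefl
      extension = hh P′ P′⊆U (x₀ , inj₁∨ Px₀) h′ h′-into h′-hom
      f = proj₁ extension
      f-s : map f s ≡ s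
      f-s = trans (proj₂ extension s P′-s) h′-s
      g : Endo N
      g = record
        { map = map f
        ; into = λ x Nx → closed x (map f x) Nx (into f x (N⊆U x Nx))
            ( (λ s⟶x → edge-via f Us (N⊆U x Nx) f-s refl s⟶x)
            , (λ x⟶s → edge-via f (N⊆U x Nx) Us refl f-s x⟶s) )
        ; hom = λ x y Nx Ny → hom f x y (N⊆U x Nx) (N⊆U y Ny)
        }

  size : (Fin m → Bool) → ℕ
  size U = ∣ tabulate U ∣

  size-< : ∀ {N U s} → N ⊆ U → T (U s) → ¬ T (N s) → size N < size U
  size-< {s = s} N⊆U Us s∉N = p⊂q⇒∣p∣<∣q∣
    ( (λ {x} x∈N → ∈-tabulate⁺ (N⊆U x (∈-tabulate⁻ x∈N)))
    , s , ∈-tabulate⁺ Us , s∉N ∘ ∈-tabulate⁻)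

  pair-injective : ∀ {a b : Fin m} → a ≢ b → Injective _≡_ _≡_ (a ∷ b ∷ [])
  pair-injective a≢b {zero} {zero} _ = refl
  pair-injective a≢b {zero} {suc zero} a≡b = contradiction a≡b a≢b
  pair-injective a≢b {suc zero} {zero} b≡a = contradiction (sym b≡a) a≢b
  pair-injective a≢b {suc zero} {suc zero} _ = refl

  module _ {U : Fin m → Bool} (hh : HomHomogeneousOn U) where

    map-nonadjacent : ∀ {x y a b} → x ≢ y → ¬ x ⟶ y → ¬ y ⟶ x →
      T (U x) → T (U y) → T (U a) → T (U b) →
      Σ (Endo U) λ g → map g x ≡ a × map g y ≡ b
    map-nonadjacent {x} {y} {a} {b} x≢y ¬x⟶y ¬y⟶x Ux Uy Ua Ub =
      g , on zero , on (suc zero)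
      where
      ¬adjacent : ∀ i j → ¬ (x ∷ y ∷ []) i ⟶ (x ∷ y ∷ []) j
      ¬adjacent zero zero = ⟶-irrefl
      ¬adjacent zero (suc zero) = ¬x⟶y
      ¬adjacent (suc zero) zero = ¬y⟶x
      ¬adjacent (suc zero) (suc zero) = ⟶-irrefl
      extension = extend-points hh (x ∷ y ∷ []) (a ∷ b ∷ []) (pair-injective x≢y)
        (λ { zero → Ux ; (suc zero) → Uy }) (λ { zero → Ua ; (suc zero) → Ub })
        (λ i j e → contradiction e (¬adjacent i j))
      g = proj₁ extension
      on = proj₂ extension

    map-vertex : ∀ {x y} → T (U x) → T (U y) → Σ (Endo U) λ g → map g x ≡ y
    map-vertex {x} {y} Ux Uy with extend-points hh {0} (const x) (const y) (λ { {zero} {zero} _ → refl })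
      (const Ux) (const Uy) (λ _ _ x⟶x → contradiction x⟶x ⟶-irrefl)
    ... | g , on = g , on zero

    out-neighbour : ∀ {a b} → T (U a) → T (U b) → a ⟶ b →
      ∀ y → T (U y) → ∃ λ z → T (U z) × y ⟶ z
    out-neighbour {a} {b} Ua Ub a⟶b y Uy with map-vertex Ua Uy
    ... | g , ga≡y = map g b , into g b Ub , edge-via g Ua Ub ga≡y refl a⟶b

module Oriented {m : ℕ} (E : Fin m → Fin m → Bool) (irr : Irreflexive (mkFin m E))
  (asym : ∀ {x y} → T (E x y) → ¬ T (E y x)) where

  open Relative E irr

  TransitiveTriangleFree : (Fin m → Bool) → Set
  TransitiveTriangleFree U =
    ∀ a b c → T (U a) → T (U b) → T (U c) → a ⟶ b → b ⟶ c → a ⟶ c → ⊥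

  IsCycle : (Fin 3 → Fin m) → Set
  IsCycle c = ∀ i → c i ⟶ c (next3 i)

  module _ {c : Fin 3 → Fin m} (cycle : IsCycle c) where

    cycle-edge : ∀ {i j} → c i ⟶ c j → j ≡ next3 i
    cycle-edge {i} {j} ci⟶cj with next3-trichotomy i j
    ... | inj₁ refl = contradiction ci⟶cj ⟶-irrefl
    ... | inj₂ (inj₁ j≡i+1) = j≡i+1
    ... | inj₂ (inj₂ refl) = contradiction (cycle j) (asym ci⟶cj)

    cycle-E : ∀ i j → E (c i) (c j) ≡ ⌊ j ≟ next3 i ⌋
    cycle-E i j with j ≟ next3 i
    ... | yes refl = Equivalence.to T-≡ (cycle i)
    ... | no j≢i+1 = ¬T⇒≡false (j≢i+1 ∘ cycle-edge)

    cycle-injective : Injective _≡_ _≡_ c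
    cycle-injective {i} {j} ci≡cj with next3-trichotomy i j
    ... | inj₁ i≡j = i≡j
    ... | inj₂ (inj₁ refl) = contradiction ci≡cj (⟶⇒≢ (cycle i))
    ... | inj₂ (inj₂ refl) = contradiction (sym ci≡cj) (⟶⇒≢ (cycle j))

  triangle-isCycle : ∀ {a b c} → a ⟶ b → b ⟶ c → c ⟶ a → IsCycle (a ∷ b ∷ c ∷ [])
  triangle-isCycle a⟶b b⟶c c⟶a zero = a⟶b
  triangle-isCycle a⟶b b⟶c c⟶a (suc zero) = b⟶c
  triangle-isCycle a⟶b b⟶c c⟶a (suc (suc zero)) = c⟶a

  triangle-⊆ : ∀ (U : Fin m → Bool) {a b c} → T (U a) → T (U b) → T (U c) →
    ∀ i → T (U ((a ∷ b ∷ c ∷ []) i))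
  triangle-⊆ U Ua Ub Uc zero = Ua
  triangle-⊆ U Ua Ub Uc (suc zero) = Ub
  triangle-⊆ U Ua Ub Uc (suc (suc zero)) = Uc

  N⁺ N⁻ : (Fin m → Bool) → Fin m → Fin m → Bool
  N⁺ U s x = U x ∧ E s x
  N⁻ U s x = U x ∧ E x s

  module Neighbourhood (U : Fin m → Bool) (s : Fin m) where

    N⁺-intro : ∀ {x} → T (U x) → s ⟶ x → T (N⁺ U s x)
    N⁺-intro Ux s⟶x = Equivalence.from T-∧ (Ux , s⟶x)

    N⁻-intro : ∀ {x} → T (U x) → x ⟶ s → T (N⁻ U s x)
    N⁻-intro Ux x⟶s = Equivalence.from T-∧ (Ux , x⟶s)

    N⁺⊆ : N⁺ U s ⊆ U
    N⁺⊆ x = proj₁ ∘ Equivalence.to T-∧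

    N⁻⊆ : N⁻ U s ⊆ U
    N⁻⊆ x = proj₁ ∘ Equivalence.to T-∧

    N⁺-edge : ∀ {x} → T (N⁺ U s x) → s ⟶ x
    N⁺-edge = proj₂ ∘ Equivalence.to T-∧

    N⁻-edge : ∀ {x} → T (N⁻ U s x) → x ⟶ s
    N⁻-edge = proj₂ ∘ Equivalence.to T-∧

  open Neighbourhood

  module _ {U : Fin m → Bool} (hh : HomHomogeneousOn U) where

    homHomogeneousOn-N⁺ : ∀ {s} → T (U s) → HomHomogeneousOn (N⁺ U s)
    homHomogeneousOn-N⁺ {s} Us =
      homHomogeneousOn-alike hh (N⁺ U s) Us (N⁺⊆ U s) (⟶-irrefl ∘ N⁺-edge U s)
      (λ x y Nx Ny → const (N⁺-edge U s Ny) , λ x⟶s → contradiction x⟶s (asym (N⁺-edge U s Nx)))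
      (λ x y Nx Uy x≼y → N⁺-intro U s Uy (proj₁ x≼y (N⁺-edge U s Nx)))

    homHomogeneousOn-N⁻ : ∀ {s} → T (U s) → HomHomogeneousOn (N⁻ U s)
    homHomogeneousOn-N⁻ {s} Us =
      homHomogeneousOn-alike hh (N⁻ U s) Us (N⁻⊆ U s) (⟶-irrefl ∘ N⁻-edge U s)
      (λ x y Nx Ny → (λ s⟶x → contradiction s⟶x (asym (N⁻-edge U s Nx))) , const (N⁻-edge U s Ny))
      (λ x y Nx Uy x≼y → N⁻-intro U s Uy (proj₂ x≼y (N⁻-edge U s Nx)))

    map-cycle : ∀ {c c′} → IsCycle c → IsCycle c′ → (∀ i → T (U (c i))) → (∀ i → T (U (c′ i))) →
      Σ (Endo U) λ g → ∀ i → map g (c i) ≡ c′ i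
    map-cycle {c} {c′} cycle cycle′ c∈U c′∈U =
      extend-points hh c c′ (cycle-injective cycle) c∈U c′∈U
      (λ i j ci⟶cj → subst (λ k → c′ i ⟶ c′ k) (sym (cycle-edge cycle ci⟶cj)) (cycle′ i))

    path-ends-adjacent : ∀ {x y z} → T (U x) → T (U y) → T (U z) →
      x ⟶ y → y ⟶ z → x ⟶ z ⊎ z ⟶ x
    path-ends-adjacent {x} {y} {z} Ux Uy Uz x⟶y y⟶z with T? (E x z) | T? (E z x)
    ... | yes x⟶z | _ = inj₁ x⟶z
    ... | no _ | yes z⟶x = inj₂ z⟶x
    ... | no ¬x⟶z | no ¬z⟶x with map-nonadjacent hh x≢z ¬x⟶z ¬z⟶x Ux Uz Ux Ux
      where
      x≢z : x ≢ z
      x≢z refl = asym x⟶y y⟶z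
    ...   | g , gx≡x , gz≡x =
      contradiction (edge-via g Ux Uy gx≡x refl x⟶y) (asym (edge-via g Uy Uz refl gz≡x y⟶z))

    module _ (ttf : TransitiveTriangleFree U) where

      out-neighbour-unique : ∀ {x y z} → T (U x) → T (U y) → T (U z) → x ⟶ y → x ⟶ z → y ≡ z
      out-neighbour-unique {x} {y} {z} Ux Uy Uz x⟶y x⟶z with y ≟ z | T? (E y z) | T? (E z y)
      ... | yes y≡z | _ | _ = y≡z
      ... | no _ | yes y⟶z | _ = ⊥-elim (ttf x y z Ux Uy Uz x⟶y y⟶z x⟶z)
      ... | no _ | no _ | yes z⟶y = ⊥-elim (ttf x z y Ux Uz Uy x⟶z z⟶y x⟶y)
      ... | no y≢z | no ¬y⟶z | no ¬z⟶y with map-nonadjacent hh y≢z ¬y⟶z ¬z⟶y Uy Uz Ux Uy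
      ...   | g , gy≡x , gz≡y = ⊥-elim (ttf (map g x) x y (into g x Ux) Ux Uy
                (edge-via g Ux Uy refl gy≡x x⟶y) x⟶y (edge-via g Ux Uz refl gz≡y x⟶z))

      edge-in-cycle : ∀ {x y} → T (U x) → T (U y) → x ⟶ y → ∃ λ w → T (U w) × y ⟶ w × w ⟶ x
      edge-in-cycle {x} {y} Ux Uy x⟶y with out-neighbour hh Ux Uy x⟶y y Uy
      ... | w , Uw , y⟶w with path-ends-adjacent Ux Uy Uw x⟶y y⟶w
      ...   | inj₁ x⟶w = ⊥-elim (ttf x y w Ux Uy Uw x⟶y y⟶w x⟶w)
      ...   | inj₂ w⟶x = w , Uw , y⟶w , w⟶x

  module _ {U : Fin m → Bool} (hh : HomHomogeneousOn U)
    (ttf⁺ : ∀ {s} → T (U s) → TransitiveTriangleFree (N⁺ U s))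
    (ttf⁻ : ∀ {s} → T (U s) → TransitiveTriangleFree (N⁻ U s)) where

    -- The edge u → v lies on a 3-cycle u v w in N⁺ s, and s → u on a 3-cycle s u w′ in N⁻ v. Mapping
    -- s u w′ onto u v w sends v to a common out-neighbour z of u, v, w; if z → s, mapping u v w onto
    -- s u z sends s to a common in-neighbour y of s, u, z. The neighbourhood hypotheses then fail.
    transitiveTriangleFree-step : TransitiveTriangleFree U
    transitiveTriangleFree-step s u v Us Uu Uv s⟶u u⟶v s⟶v = from-cycles
      (edge-in-cycle (homHomogeneousOn-N⁺ hh Us) (ttf⁺ Us)
        (N⁺-intro U s Uu s⟶u) (N⁺-intro U s Uv s⟶v) u⟶v)
      (edge-in-cycle (homHomogeneousOn-N⁻ hh Uv) (ttf⁻ Uv)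
        (N⁻-intro U v Us s⟶v) (N⁻-intro U v Uu u⟶v) s⟶u)
      where
      from-cycles : (∃ λ w → T (N⁺ U s w) × v ⟶ w × w ⟶ u) →
        (∃ λ w′ → T (N⁻ U v w′) × u ⟶ w′ × w′ ⟶ s) → ⊥
      from-cycles (w , N⁺w , v⟶w , w⟶u) (w′ , N⁻w′ , u⟶w′ , w′⟶s) =
        z-cases (path-ends-adjacent hh Us Uu Uz s⟶u u⟶z)
        where
        Uw : T (U w)
        Uw = N⁺⊆ U s w N⁺w
        s⟶w : s ⟶ w
        s⟶w = N⁺-edge U s N⁺w
        cycle-uvw : IsCycle (u ∷ v ∷ w ∷ [])
        cycle-uvw = triangle-isCycle u⟶v v⟶w w⟶u
        uvw⊆U : ∀ i → T (U ((u ∷ v ∷ w ∷ []) i))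
        uvw⊆U = triangle-⊆ U Uu Uv Uw
        g,on : Σ (Endo U) λ g → ∀ i → map g ((s ∷ u ∷ w′ ∷ []) i) ≡ (u ∷ v ∷ w ∷ []) i
        g,on = map-cycle hh (triangle-isCycle s⟶u u⟶w′ w′⟶s) cycle-uvw
          (triangle-⊆ U Us Uu (N⁻⊆ U v w′ N⁻w′)) uvw⊆U
        g = proj₁ g,on
        z = map g v
        Uz : T (U z)
        Uz = into g v Uv
        u⟶z : u ⟶ z
        u⟶z = edge-via g Us Uv (proj₂ g,on zero) refl s⟶v
        v⟶z : v ⟶ z
        v⟶z = edge-via g Uu Uv (proj₂ g,on (suc zero)) refl u⟶v
        w⟶z : w ⟶ z
        w⟶z = edge-via g (N⁻⊆ U v w′ N⁻w′) Uv (proj₂ g,on (suc (suc zero))) refl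
          (N⁻-edge U v N⁻w′)
        z-cases : s ⟶ z ⊎ z ⟶ s → ⊥
        z-cases (inj₁ s⟶z) = ⟶⇒≢ v⟶z (out-neighbour-unique (homHomogeneousOn-N⁺ hh Us) (ttf⁺ Us)
          (N⁺-intro U s Uu s⟶u) (N⁺-intro U s Uv s⟶v) (N⁺-intro U s Uz s⟶z) u⟶v u⟶z)
        z-cases (inj₂ z⟶s) =
          y-cases (path-ends-adjacent (homHomogeneousOn-N⁻ hh Uu) N⁻y N⁻s N⁻w y⟶s s⟶w)
          where
          g′,on : Σ (Endo U) λ g′ → ∀ i → map g′ ((u ∷ v ∷ w ∷ []) i) ≡ (s ∷ u ∷ z ∷ []) i
          g′,on = map-cycle hh cycle-uvw (triangle-isCycle s⟶u u⟶z z⟶s) uvw⊆U (triangle-⊆ U Us Uu Uz)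
          g′ = proj₁ g′,on
          y = map g′ s
          y⟶s : y ⟶ s
          y⟶s = edge-via g′ Us Uu refl (proj₂ g′,on zero) s⟶u
          y⟶u : y ⟶ u
          y⟶u = edge-via g′ Us Uv refl (proj₂ g′,on (suc zero)) s⟶v
          y⟶z : y ⟶ z
          y⟶z = edge-via g′ Us Uw refl (proj₂ g′,on (suc (suc zero))) s⟶w
          N⁻y : T (N⁻ U u y)
          N⁻y = N⁻-intro U u (into g′ s Us) y⟶u
          N⁻s : T (N⁻ U u s)
          N⁻s = N⁻-intro U u Us s⟶u
          N⁻w : T (N⁻ U u w)
          N⁻w = N⁻-intro U u Uw w⟶u
          y-cases : y ⟶ w ⊎ w ⟶ y → ⊥
          y-cases (inj₁ y⟶w) = ttf⁻ Uu y s w N⁻y N⁻s N⁻w y⟶s s⟶w y⟶w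
          y-cases (inj₂ w⟶y) = ⟶⇒≢ u⟶z (out-neighbour-unique (homHomogeneousOn-N⁺ hh Uw) (ttf⁺ Uw)
            (N⁺-intro U w (into g′ s Us) w⟶y) (N⁺-intro U w Uu w⟶u) (N⁺-intro U w Uz w⟶z) y⟶u y⟶z)

  transitiveTriangleFree : ∀ {U} → HomHomogeneousOn U → TransitiveTriangleFree U
  transitiveTriangleFree {U} = All.wfRec (On.wellFounded size <-wellFounded) _
    (λ U → HomHomogeneousOn U → TransitiveTriangleFree U) step U
    where
    step : ∀ U → (∀ {N} → size N < size U → HomHomogeneousOn N → TransitiveTriangleFree N) →
      HomHomogeneousOn U → TransitiveTriangleFree U
    step U rec hh = transitiveTriangleFree-step hh
      (λ {s} Us → rec (size-< (N⁺⊆ U s) Us (⟶-irrefl ∘ N⁺-edge U s)) (homHomogeneousOn-N⁺ hh Us))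
      (λ {s} Us → rec (size-< (N⁻⊆ U s) Us (⟶-irrefl ∘ N⁻-edge U s)) (homHomogeneousOn-N⁻ hh Us))

InBlock : ∀ {m n} → (Fin m → Fin n → Fin m) → Fin m → Fin m → Set
InBlock block r y = ∃ λ j → block r j ≡ y

-- A partition of the vertices into blocks of size n, enumerated so that edges inside a block follow K.
record Blocks {m} (E : Fin m → Fin m → Bool) (n : ℕ) (K : Fin n → Fin n → Bool) : Set where
  field
    block           : Fin m → Fin n → Fin m
    block-injective : ∀ r → Injective _≡_ _≡_ (block r)
    block-edge      : ∀ r i j → E (block r i) (block r j) ≡ K i j
    in-own-block    : ∀ r → InBlock block r r
    in-block-sym    : ∀ {x y} → InBlock block x y → InBlock block y x
    in-block-trans  : ∀ {x y z} → InBlock block x y → InBlock block y z → InBlock block x z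
    edge⇒in-block   : ∀ {x y} → T (E x y) → InBlock block x y

BlockDigraph : (k n : ℕ) → (Fin n → Fin n → Bool) → Digraph
BlockDigraph k n K = record
  { V = Fin k × Fin n
  ; E = λ p q → ⌊ proj₁ p ≟ proj₁ q ⌋ ∧ K (proj₂ p) (proj₂ q)
  }

module _ {m n} {E : Fin m → Fin m → Bool} {K : Fin n → Fin n → Bool} (B : Blocks E n K) where

  open Blocks B

  record Representatives : Set where
    field
      k             : ℕ
      rep           : Fin k → Fin m
      rep-separated : ∀ i j → InBlock block (rep i) (rep j) → i ≡ j

  open Representatives

  Covers : Representatives → Fin m → Set
  Covers R x = ∃ λ i → InBlock block (rep R i) x

  add-representative : (R : Representatives) (x : Fin m) → ¬ Covers R x → Representatives
  add-representative R x x∉R = record { k = suc (k R) ; rep = x ∷ rep R ; rep-separated = separated }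
    where
    separated : ∀ i j → InBlock block ((x ∷ rep R) i) ((x ∷ rep R) j) → i ≡ j
    separated zero zero _ = refl
    separated zero (suc j) x~j = contradiction (j , in-block-sym x~j) x∉R
    separated (suc i) zero i~x = contradiction (i , i~x) x∉R
    separated (suc i) (suc j) i~j = cong suc (rep-separated R i j i~j)

  cover : (xs : List (Fin m)) → Σ Representatives λ R → ∀ {x} → x ∈ᴸ xs → Covers R x
  cover []ᴸ = record { k = 0 ; rep = λ () ; rep-separated = λ () } , λ ()
  cover (x ∷ᴸ xs) with cover xs
  ... | R , covers with any? (λ i → any? (λ j → block (rep R i) j ≟ x))
  ...   | yes x∈R = R , λ { (here refl) → x∈R ; (there y∈xs) → covers y∈xs }
  ...   | no x∉R = add-representative R x x∉R , λ
          { (here refl) → zero , in-own-block x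
          ; (there y∈xs) → suc (proj₁ (covers y∈xs)) , proj₂ (covers y∈xs) }

  blocks⇒≅ : Fin m → Σ ℕ λ k → k ≥ 1 × (mkFin m E ≅ BlockDigraph k n K)
  blocks⇒≅ x₀ =
    k R , ≤-trans (s≤s z≤n) (toℕ<n (proj₁ (covered x₀))) , mk↔ₛ′ to from to∘from from∘to , edges
    where
    R = proj₁ (cover (allFin m))
    covered : ∀ x → Covers R x
    covered x = proj₂ (cover (allFin m)) (∈-allFin x)
    from : Fin (k R) × Fin n → Fin m
    from (i , j) = block (rep R i) j
    to : Fin m → Fin (k R) × Fin n
    to x = proj₁ (covered x) , proj₁ (proj₂ (covered x))
    from∘to : ∀ x → from (to x) ≡ x
    from∘to x = proj₂ (proj₂ (covered x))
    to∘from : ∀ p → to (from p) ≡ p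
    to∘from (i , j) with covered (block (rep R i) j)
    ... | i′ , j′ , i′j′≡ij
      with rep-separated R i′ i (in-block-trans (j′ , i′j′≡ij) (in-block-sym (j , refl)))
    ...   | refl = cong (i ,_) (block-injective (rep R i) i′j′≡ij)
    E-from : ∀ p q → E (from p) (from q) ≡ Digraph.E (BlockDigraph (k R) n K) p q
    E-from (i , j) (i′ , j′) with i ≟ i′
    ... | yes refl = block-edge (rep R i) j j′
    ... | no i≢i′ = ¬T⇒≡false λ edge → i≢i′ (rep-separated R i i′
          (in-block-trans (j , refl) (in-block-trans (edge⇒in-block edge) (in-block-sym (j′ , refl)))))
    edges : ∀ x y → E x y ≡ Digraph.E (BlockDigraph (k R) n K) (to x) (to y)
    edges x y = trans (sym (cong₂ E (from∘to x) (from∘to y))) (E-from (to x) (to y))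

module OrientedClassification {m : ℕ} (E : Fin m → Fin m → Bool) (irr : Irreflexive (mkFin m E))
  (asym : ∀ {x y} → T (E x y) → ¬ T (E y x)) (hh : HomHomogeneous m E)
  {a b : Fin m} (a⟶b : T (E a b)) where

  open Relative E irr
  open Oriented E irr asym

  hh₀ : HomHomogeneousOn everything
  hh₀ = homHomogeneous⇒On-everything hh

  successor : Fin m → Fin m
  successor x = proj₁ (out-neighbour hh₀ tt tt a⟶b x tt)

  ⟶successor : ∀ x → x ⟶ successor x
  ⟶successor x = proj₂ (proj₂ (out-neighbour hh₀ tt tt a⟶b x tt))

  ⟶⇒≡successor : ∀ {x y} → x ⟶ y → y ≡ successor x
  ⟶⇒≡successor x⟶y =
    out-neighbour-unique hh₀ (transitiveTriangleFree hh₀) tt tt tt x⟶y (⟶successor _)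

  path-closes : ∀ {x y z} → x ⟶ y → y ⟶ z → z ⟶ x
  path-closes {x} {y} {z} x⟶y y⟶z with path-ends-adjacent hh₀ tt tt tt x⟶y y⟶z
  ... | inj₁ x⟶z = ⊥-elim (transitiveTriangleFree hh₀ x y z tt tt tt x⟶y y⟶z x⟶z)
  ... | inj₂ z⟶x = z⟶x

  successor³ : ∀ x → successor (successor (successor x)) ≡ x
  successor³ x = sym (⟶⇒≡successor (path-closes (⟶successor x) (⟶successor (successor x))))

  block : Fin m → Fin 3 → Fin m
  block r = r ∷ successor r ∷ successor (successor r) ∷ []

  block-isCycle : ∀ r → IsCycle (block r)
  block-isCycle r = triangle-isCycle (⟶successor r) (⟶successor (successor r))
    (path-closes (⟶successor r) (⟶successor (successor r)))

  block-successor : ∀ r j → block (successor r) j ≡ block r (next3 j)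
  block-successor r zero = refl
  block-successor r (suc zero) = refl
  block-successor r (suc (suc zero)) = successor³ r

  in-block-of-successor : ∀ {r y} → InBlock block (successor r) y → InBlock block r y
  in-block-of-successor {r} (j , eq) = next3 j , trans (sym (block-successor r j)) eq

  blocks : Blocks E 3 (λ i j → ⌊ j ≟ next3 i ⌋)
  blocks = record
    { block = block
    ; block-injective = cycle-injective ∘ block-isCycle
    ; block-edge = cycle-E ∘ block-isCycle
    ; in-own-block = λ r → zero , refl
    ; in-block-sym = λ
        { (zero , refl) → zero , refl
        ; (suc zero , refl) → suc (suc zero) , successor³ _
        ; (suc (suc zero) , refl) → suc zero , successor³ _ }
    ; in-block-trans = λ
        { (zero , refl) y~z → y~z
        ; (suc zero , refl) y~z → in-block-of-successor y~z
        ; (suc (suc zero) , refl) y~z → in-block-of-successor (in-block-of-successor y~z) }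
    ; edge⇒in-block = λ x⟶y → suc zero , sym (⟶⇒≡successor x⟶y)
    }

module SymmetricClassification {m : ℕ} (E : Fin m → Fin m → Bool) (irr : Irreflexive (mkFin m E))
  (hh : HomHomogeneous m E) {a b : Fin m} (a⟶b : T (E a b)) (b⟶a : T (E b a)) where

  open Relative E irr

  hh₀ : HomHomogeneousOn everything
  hh₀ = homHomogeneous⇒On-everything hh

  record Clique : Set where
    field
      k        : ℕ
      vertex   : Fin (2 + k) → Fin m
      adjacent : ∀ {i j} → i ≢ j → vertex i ⟶ vertex j

  open Clique

  order : Clique → ℕ
  order C = 2 + k C

  vertex-injective : ∀ C → Injective _≡_ _≡_ (vertex C)
  vertex-injective C {i} {j} eq with i ≟ j
  ... | yes i≡j = i≡j
  ... | no i≢j = contradiction eq (⟶⇒≢ (adjacent C i≢j))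

  order≤m : ∀ C → order C ≤ m
  order≤m C = injective⇒≤ (vertex-injective C)

  _∈C_ : Fin m → Clique → Set
  y ∈C C = ∃ λ i → vertex C i ≡ y

  Closed : Clique → Set
  Closed C = ∀ i y → vertex C i ⟶ y → y ∈C C

  map-clique : Endo everything → Clique → Clique
  map-clique g C = record { k = k C ; vertex = map g ∘ vertex C ; adjacent = hom g _ _ tt tt ∘ adjacent C }

  Bidirected : Fin m → Fin m → Set
  Bidirected u x = u ⟶ x × x ⟶ u

  extend-clique : (C : Clique) (u : Fin m) → (∀ j → Bidirected u (vertex C j)) → Clique
  extend-clique C u u⇄C = record { k = suc (k C) ; vertex = u ∷ vertex C ; adjacent = adjacent′ }
    where
    adjacent′ : ∀ {i j} → i ≢ j → (u ∷ vertex C) i ⟶ (u ∷ vertex C) j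
    adjacent′ {zero} {zero} 0≢0 = contradiction refl 0≢0
    adjacent′ {zero} {suc j} _ = proj₁ (u⇄C j)
    adjacent′ {suc i} {zero} _ = proj₂ (u⇄C i)
    adjacent′ {suc i} {suc j} i≢j = adjacent C (i≢j ∘ cong suc)

  -- u is the image of vertex i under an endomorphism fixing the other vertices and sending v to vertex i.
  record Substitute (C : Clique) (i : Fin (order C)) (v : Fin m) : Set where
    field
      u       : Fin m
      others  : ∀ j → j ≢ i → Bidirected u (vertex C j)
      forward : vertex C i ⟶ v → u ⟶ vertex C i
      back    : v ⟶ vertex C i → vertex C i ⟶ u

    bidirected-all : vertex C i ⟶ v → v ⟶ vertex C i → ∀ j → Bidirected u (vertex C j)
    bidirected-all i⟶v v⟶i j with j ≟ i
    ... | yes refl = forward i⟶v , back v⟶i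
    ... | no j≢i = others j j≢i

  substitute : (C : Clique) (i : Fin (order C)) (v : Fin m) → ¬ v ∈C C → Substitute C i v
  substitute C i v v∉C = record
    { u = map g (vertex C i)
    ; others = λ j j≢i → edge-via g tt tt refl (fixes j≢i) (adjacent C (j≢i ∘ sym))
                       , edge-via g tt tt (fixes j≢i) refl (adjacent C j≢i)
    ; forward = edge-via g tt tt refl v↦i
    ; back = edge-via g tt tt v↦i refl
    }
    where
    pt : Fin (order C) → Fin m
    pt = updateAt (vertex C) i (const v)
    pt-i : pt i ≡ v
    pt-i = updateAt-updates i (vertex C)
    pt-other : ∀ {j} → j ≢ i → pt j ≡ vertex C j
    pt-other {j} j≢i = updateAt-minimal j i (vertex C) j≢i
    pt-injective : Injective _≡_ _≡_ pt
    pt-injective {j} {l} eq with j ≟ i | l ≟ i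
    ... | yes refl | yes refl = refl
    ... | yes refl | no l≢i = contradiction (l , trans (sym (pt-other l≢i)) (trans (sym eq) pt-i)) v∉C
    ... | no j≢i | yes refl = contradiction (j , trans (sym (pt-other j≢i)) (trans eq pt-i)) v∉C
    ... | no j≢i | no l≢i = vertex-injective C (trans (sym (pt-other j≢i)) (trans eq (pt-other l≢i)))
    extension = extend-points hh₀ pt (vertex C) pt-injective (const tt) (const tt)
      (λ j l pj⟶pl → adjacent C λ { refl → ⟶-irrefl pj⟶pl })
    g = proj₁ extension
    fixes : ∀ {j} → j ≢ i → map g (vertex C j) ≡ vertex C j
    fixes j≢i = trans (cong (map g) (sym (pt-other j≢i))) (proj₂ extension _)
    v↦i : map g v ≡ vertex C i
    v↦i = trans (cong (map g) (sym pt-i)) (proj₂ extension i)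

  other : ∀ {k} → Fin (2 + k) → Fin (2 + k)
  other zero = suc zero
  other (suc _) = zero

  other≢ : ∀ {k} (i : Fin (2 + k)) → other i ≢ i
  other≢ zero ()
  other≢ (suc _) ()

  -- If the substitute u for vertex i is not joined back to i, substitute u for a second vertex instead.
  grow : (C : Clique) (i : Fin (order C)) (v : Fin m) → ¬ v ∈C C → vertex C i ⟶ v →
    Σ Clique λ C′ → order C′ ≡ suc (order C)
  grow C i v v∉C i⟶v with T? (E v (vertex C i))
  ... | yes v⟶i = extend-clique C u (bidirected-all i⟶v v⟶i) , refl
    where open Substitute (substitute C i v v∉C)
  ... | no _ =
    extend-clique C (Substitute.u S′) (Substitute.bidirected-all S′ (proj₂ u⇄i′) (proj₁ u⇄i′)) , refl
    where
    S = substitute C i v v∉C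
    u⟶C : ∀ j → Substitute.u S ⟶ vertex C j
    u⟶C j with j ≟ i
    ... | yes refl = Substitute.forward S i⟶v
    ... | no j≢i = proj₁ (Substitute.others S j j≢i)
    u∉C : ¬ Substitute.u S ∈C C
    u∉C (j , j≡u) = ⟶⇒≢ (u⟶C j) (sym j≡u)
    u⇄i′ : Bidirected (Substitute.u S) (vertex C (other i))
    u⇄i′ = Substitute.others S (other i) (other≢ i)
    S′ = substitute C (other i) (Substitute.u S) u∉C

  closed-or-grows : (C : Clique) → Closed C ⊎ Σ Clique λ C′ → order C′ ≡ suc (order C)
  closed-or-grows C
    with any? (λ i → any? (λ y → T? (E (vertex C i) y) ×-dec ¬? (any? (λ j → vertex C j ≟ y))))
  ... | yes (i , y , i⟶y , y∉C) = inj₂ (grow C i y y∉C i⟶y)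
  ... | no ¬escape = inj₁ λ i y i⟶y →
          decidable-stable (any? (λ j → vertex C j ≟ y)) λ y∉C → ¬escape (i , y , i⟶y , y∉C)

  closed-clique : ∀ f (C : Clique) → m ≤ order C + f → Σ Clique Closed
  closed-clique f C m≤ with closed-or-grows C
  ... | inj₁ closed = C , closed
  closed-clique zero C m≤ | inj₂ (C′ , refl) =
    ⊥-elim (<-irrefl refl (≤-trans (order≤m C′) (subst (m ≤_) (+-identityʳ (order C)) m≤)))
  closed-clique (suc f) C m≤ | inj₂ (C′ , refl) =
    closed-clique f C′ (≤-trans m≤ (≤-reflexive (+-suc (order C) f)))

  closed⇒largest : ∀ C → Closed C → ∀ C′ → order C′ ≤ order C
  closed⇒largest C closed C′ = injective⇒≤ {f = index} index-injective
    where
    g,first = map-vertex hh₀ {vertex C′ zero} {vertex C zero} tt tt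
    image = map-clique (proj₁ g,first) C′
    member : ∀ j → vertex image j ∈C C
    member j with j ≟ zero
    ... | yes refl = zero , sym (proj₂ g,first)
    ... | no j≢0 =
      closed zero _ (edge-via (proj₁ g,first) tt tt (proj₂ g,first) refl (adjacent C′ (j≢0 ∘ sym)))
    index : Fin (order C′) → Fin (order C)
    index j = proj₁ (member j)
    index-injective : Injective _≡_ _≡_ index
    index-injective {i} {j} eq =
      vertex-injective image (trans (sym (proj₂ (member i))) (trans (cong (vertex C) eq) (proj₂ (member j))))

  pair-clique : Clique
  pair-clique = record { k = 0 ; vertex = a ∷ b ∷ [] ; adjacent = adjacent-ab }
    where
    adjacent-ab : ∀ {i j} → i ≢ j → (a ∷ b ∷ []) i ⟶ (a ∷ b ∷ []) j
    adjacent-ab {zero} {zero} 0≢0 = contradiction refl 0≢0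
    adjacent-ab {zero} {suc zero} _ = a⟶b
    adjacent-ab {suc zero} {zero} _ = b⟶a
    adjacent-ab {suc zero} {suc zero} 1≢1 = contradiction refl 1≢1

  abstract
    largest : Σ Clique Closed
    largest = closed-clique m pair-clique (m≤n+m m 2)

  n : ℕ
  n = order (proj₁ largest)

  clique-at : Fin m → Clique
  clique-at r = map-clique (proj₁ (map-vertex hh₀ {vertex (proj₁ largest) zero} {r} tt tt)) (proj₁ largest)

  block : Fin m → Fin n → Fin m
  block r = vertex (clique-at r)

  block-first : ∀ r → block r zero ≡ r
  block-first r = proj₂ (map-vertex hh₀ tt tt)

  no-larger-clique : ∀ C′ → order C′ ≢ suc n
  no-larger-clique C′ order≡ =
    <-irrefl refl (subst (_≤ n) order≡ (closed⇒largest (proj₁ largest) (proj₂ largest) C′))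

  maximum-order⇒closed : ∀ C → order C ≡ n → Closed C
  maximum-order⇒closed C order≡n with closed-or-grows C
  ... | inj₁ closed = closed
  ... | inj₂ (C′ , order≡) = ⊥-elim (no-larger-clique C′ (trans order≡ (cong suc order≡n)))

  clique-at-closed : ∀ r → Closed (clique-at r)
  clique-at-closed r = maximum-order⇒closed (clique-at r) refl

  first⟶ : ∀ r {j} → j ≢ zero → r ⟶ block r j
  first⟶ r {j} j≢0 = subst (λ x → x ⟶ block r j) (block-first r) (adjacent (clique-at r) (j≢0 ∘ sym))

  ⟶first : ∀ r {j} → j ≢ zero → block r j ⟶ r
  ⟶first r {j} j≢0 = subst (λ x → block r j ⟶ x) (block-first r) (adjacent (clique-at r) j≢0)

  edge⇒in-block : ∀ {x y} → x ⟶ y → InBlock block x y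
  edge⇒in-block {x} x⟶y = clique-at-closed x zero _ (subst (_⟶ _) (sym (block-first x)) x⟶y)

  blocks : Blocks E n (λ i j → not ⌊ i ≟ j ⌋)
  blocks = record
    { block = block
    ; block-injective = vertex-injective ∘ clique-at
    ; block-edge = block-edge
    ; in-own-block = λ r → zero , block-first r
    ; in-block-sym = in-block-sym
    ; in-block-trans = in-block-trans
    ; edge⇒in-block = edge⇒in-block
    }
    where
    block-edge : ∀ r i j → E (block r i) (block r j) ≡ not ⌊ i ≟ j ⌋
    block-edge r i j with i ≟ j
    ... | yes refl = irr _
    ... | no i≢j = Equivalence.to T-≡ (adjacent (clique-at r) i≢j)
    in-block-sym : ∀ {x y} → InBlock block x y → InBlock block y x
    in-block-sym {x} {y} (j , x~y) with j ≟ zero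
    ... | yes refl = zero , trans (block-first y) (trans (sym x~y) (block-first x))
    ... | no j≢0 = edge⇒in-block (subst (λ w → w ⟶ x) x~y (⟶first x j≢0))
    in-block-trans : ∀ {x y z} → InBlock block x y → InBlock block y z → InBlock block x z
    in-block-trans {x} {y} {z} (j , x~y) (l , y~z) with l ≟ zero
    ... | yes refl = j , trans x~y (trans (sym (block-first y)) y~z)
    ... | no l≢0 = clique-at-closed x j z (subst₂ _⟶_ (sym x~y) y~z (first⟶ y l≢0))

edgeless-blocks : ∀ {m} (E : Fin m → Fin m → Bool) → Irreflexive (mkFin m E) →
  (∀ x y → ¬ T (E x y)) →
  Blocks E 1 (λ i j → not ⌊ i ≟ j ⌋)
edgeless-blocks E irr no-edge = record
  { block = λ r _ → r
  ; block-injective = λ { r {zero} {zero} _ → refl }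
  ; block-edge = λ { r zero zero → irr r }
  ; in-own-block = λ r → zero , refl
  ; in-block-sym = λ { (zero , refl) → zero , refl }
  ; in-block-trans = λ { (zero , refl) (zero , refl) → zero , refl }
  ; edge⇒in-block = λ {x} {y} x⟶y → contradiction x⟶y (no-edge x y)
  }

PartialHomsExtend : Digraph → Set
PartialHomsExtend D = ∀ (P : V D → Bool) (h : V D → V D) →
  (∀ x y → T (P x) → T (P y) → T (E D x y) → T (E D (h x) (h y))) →
  Σ (V D → V D) λ g → IsHom D D g × (∀ x → T (P x) → g x ≡ h x)

partialHomsExtend⇒homHomogeneous : ∀ m (F : Fin m → Fin m → Bool) →
  PartialHomsExtend (mkFin m F) → HomHomogeneous m F
partialHomsExtend⇒homHomogeneous m F extend W₁ W₂ _ _ f f-hom =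
  proj₁ extension , proj₁ (proj₂ extension) , agrees
  where
  h : Fin m → Fin m
  h x with x ∈? W₁
  ... | yes x∈W₁ = proj₁ (f (x , x∈W₁))
  ... | no _ = x
  h-on : ∀ {x} (x∈W₁ : x ∈ W₁) → h x ≡ proj₁ (f (x , x∈W₁))
  h-on {x} x∈W₁ with x ∈? W₁
  ... | yes x∈W₁′ = cong (λ p → proj₁ (f (x , p))) ([]=-irrelevant x∈W₁′ x∈W₁)
  ... | no x∉W₁ = contradiction x∈W₁ x∉W₁
  P : Fin m → Bool
  P x = ⌊ x ∈? W₁ ⌋
  h-hom : ∀ x y → T (P x) → T (P y) → T (F x y) → T (F (h x) (h y))
  h-hom x y Px Py = subst₂ (λ a b → T (F a b)) (sym (h-on (toWitness Px))) (sym (h-on (toWitness Py)))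
    ∘ f-hom (x , toWitness Px) (y , toWitness Py)
  extension = extend P h h-hom
  agrees : ∀ x (x∈W₁ : x ∈ W₁) → proj₁ extension x ≡ proj₁ (f (x , x∈W₁))
  agrees x x∈W₁ = trans (proj₂ (proj₂ extension) x (fromWitness x∈W₁)) (h-on x∈W₁)

partialHomsExtend-≅ : ∀ {D₁ D₂} → D₁ ≅ D₂ → PartialHomsExtend D₂ → PartialHomsExtend D₁
partialHomsExtend-≅ {D₁} {D₂} (φ , φ-edge) extend P h h-hom = g , g-hom , agrees
  where
  open Inverse φ using (to; from; strictlyInverseˡ; strictlyInverseʳ)
  edge-from : ∀ u v → E D₁ (from u) (from v) ≡ E D₂ u v
  edge-from u v = trans (φ-edge (from u) (from v)) (cong₂ (E D₂) (strictlyInverseˡ u) (strictlyInverseˡ v))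
  h₂ : V D₂ → V D₂
  h₂ = to ∘ h ∘ from
  h₂-hom : ∀ u v → T (P (from u)) → T (P (from v)) → T (E D₂ u v) → T (E D₂ (h₂ u) (h₂ v))
  h₂-hom u v Pu Pv = subst T (φ-edge _ _) ∘ h-hom _ _ Pu Pv ∘ subst T (sym (edge-from u v))
  extension = extend (P ∘ from) h₂ h₂-hom
  g : V D₁ → V D₁
  g = from ∘ proj₁ extension ∘ to
  g-hom : IsHom D₁ D₁ g
  g-hom x y = subst T (sym (edge-from _ _)) ∘ proj₁ (proj₂ extension) (to x) (to y) ∘ subst T (φ-edge x y)
  agrees : ∀ x → T (P x) → g x ≡ h x
  agrees x Px = begin
    from (proj₁ extension (to x))  ≡⟨ cong from (proj₂ (proj₂ extension) (to x) P-from-to) ⟩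
    from (to (h (from (to x))))    ≡⟨ strictlyInverseʳ _ ⟩
    h (from (to x))                ≡⟨ cong h (strictlyInverseʳ x) ⟩
    h x                            ∎
    where
    open ≡-Reasoning
    P-from-to : T (P (from (to x)))
    P-from-to = subst (T ∘ P) (sym (strictlyInverseʳ x)) Px

Block : (n : ℕ) → (Fin n → Fin n → Bool) → Digraph
Block n K = record { V = Fin n ; E = K }

-- A partial homomorphism of k copies of a connected block acts on each touched copy by a partial
-- homomorphism into a single copy; extend it copywise.
blockDigraph-partialHomsExtend : ∀ {n} (K : Fin n → Fin n → Bool) →
  (∀ a b → a ≢ b → T (K a b) ⊎ T (K b a)) → PartialHomsExtend (Block n K) →
  ∀ k → PartialHomsExtend (BlockDigraph k n K)
blockDigraph-partialHomsExtend {n} K connected extend k P h h-hom = g , g-hom , agrees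
  where
  D = BlockDigraph k n K
  edge⁻ : ∀ {p q} → T (E D p q) → proj₁ p ≡ proj₁ q × T (K (proj₂ p) (proj₂ q))
  edge⁻ {p} {q} pq =
    toWitness (proj₁ (Equivalence.to (T-∧ {⌊ proj₁ p ≟ proj₁ q ⌋}) pq)) , proj₂ (Equivalence.to T-∧ pq)
  edge⁺ : ∀ {i a b} → T (K a b) → T (E D (i , a) (i , b))
  edge⁺ {i} ab = Equivalence.from T-∧ (fromWitness {a? = i ≟ i} refl , ab)
  same-copy : ∀ {i a b} → T (P (i , a)) → T (P (i , b)) → proj₁ (h (i , a)) ≡ proj₁ (h (i , b))
  same-copy {i} {a} {b} Pa Pb with a ≟ b
  ... | yes refl = refl
  ... | no a≢b with connected a b a≢b
  ...   | inj₁ ab = proj₁ (edge⁻ (h-hom _ _ Pa Pb (edge⁺ ab)))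
  ...   | inj₂ ba = sym (proj₁ (edge⁻ (h-hom _ _ Pb Pa (edge⁺ ba))))
  on-copy : ∀ i → Σ (Fin n → Fin n) λ σ → (∀ a b → T (K a b) → T (K (σ a) (σ b))) ×
    (∀ a → T (P (i , a)) → σ a ≡ proj₂ (h (i , a)))
  on-copy i = extend (λ a → P (i , a)) (λ a → proj₂ (h (i , a)))
    (λ a b Pa Pb ab → proj₂ (edge⁻ (h-hom _ _ Pa Pb (edge⁺ ab))))
  g-copy : ∀ i → Dec (∃ λ a → T (P (i , a))) → Fin n → Fin k × Fin n
  g-copy i (yes (a₀ , _)) a = proj₁ (h (i , a₀)) , proj₁ (on-copy i) a
  g-copy i (no _) a = i , a
  touched? : ∀ i → Dec (∃ λ a → T (P (i , a)))
  touched? i = any? (λ a → T? (P (i , a)))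
  g : Fin k × Fin n → Fin k × Fin n
  g (i , a) = g-copy i (touched? i) a
  g-copy-hom : ∀ i d a b → T (K a b) → T (E D (g-copy i d a) (g-copy i d b))
  g-copy-hom i (yes _) a b ab = edge⁺ (proj₁ (proj₂ (on-copy i)) a b ab)
  g-copy-hom i (no _) a b ab = edge⁺ ab
  g-hom : IsHom D D g
  g-hom (i , a) (j , b) pq with edge⁻ {i , a} {j , b} pq
  ... | refl , ab = g-copy-hom i (touched? i) a b ab
  agrees : ∀ x → T (P x) → g x ≡ h x
  agrees (i , a) Pa with touched? i
  ... | yes (a₀ , Pa₀) = cong₂ _,_ (same-copy Pa₀ Pa) (proj₂ (proj₂ (on-copy i)) a Pa)
  ... | no untouched = contradiction (a , Pa) untouched

transpose-matchˡ : ∀ {n} (i j : Fin n) → transpose i j i ≡ j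
transpose-matchˡ i j rewrite dec-true (i ≟ i) refl = refl

transpose-other : ∀ {n} {i j k : Fin n} → k ≢ i → k ≢ j → transpose i j k ≡ k
transpose-other {i = i} {j} {k} k≢i k≢j rewrite dec-false (k ≟ i) k≢i | dec-false (k ≟ j) k≢j = refl

transpose-injective : ∀ {n} (i j : Fin n) → Injective _≡_ _≡_ (transpose i j)
transpose-injective i j {x} {y} eq = begin
  x                            ≡⟨ transpose-inverse j i ⟨
  transpose j i (transpose i j x) ≡⟨ cong (transpose j i) eq ⟩
  transpose j i (transpose i j y) ≡⟨ transpose-inverse j i ⟩
  y                            ∎
  where open ≡-Reasoning

-- Composing with the transposition of σ a and τ a fixes a without moving points already fixed.
extend-injection : ∀ {n} (Q : Fin n → Bool) (τ : Fin n → Fin n) →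
  (∀ {a b} → T (Q a) → T (Q b) → τ a ≡ τ b → a ≡ b) →
  Σ (Fin n → Fin n) λ σ → Injective _≡_ _≡_ σ × (∀ a → T (Q a) → σ a ≡ τ a)
extend-injection {n} Q τ τ-injective with adjust (allFin n)
  where
  Agrees : List (Fin n) → (Fin n → Fin n) → Set
  Agrees xs σ = ∀ {a} → a ∈ᴸ xs → T (Q a) → σ a ≡ τ a
  adjust : ∀ xs → Σ (Fin n → Fin n) λ σ → Injective _≡_ _≡_ σ × Agrees xs σ
  adjust []ᴸ = id , id , λ ()
  adjust (a ∷ᴸ xs) with adjust xs | T? (Q a)
  ... | σ , σ-injective , σ-agrees | no ¬Qa =
    σ , σ-injective , λ { (here refl) Qa → contradiction Qa ¬Qa ; (there b∈xs) → σ-agrees b∈xs }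
  ... | σ , σ-injective , σ-agrees | yes Qa =
    transpose (σ a) (τ a) ∘ σ , σ-injective ∘ transpose-injective (σ a) (τ a) , agrees
    where
    agrees : Agrees (a ∷ᴸ xs) (transpose (σ a) (τ a) ∘ σ)
    agrees (here refl) _ = transpose-matchˡ (σ a) (τ a)
    agrees {b} (there b∈xs) Qb with b ≟ a
    ... | yes refl = transpose-matchˡ (σ a) (τ a)
    ... | no b≢a = trans (transpose-other (b≢a ∘ σ-injective)
                     (b≢a ∘ τ-injective Qb Qa ∘ trans (sym (σ-agrees b∈xs Qb))))
                     (σ-agrees b∈xs Qb)
... | σ , σ-injective , σ-agrees = σ , σ-injective , λ a → σ-agrees (∈-allFin a)

complete-partialHomsExtend : ∀ n → PartialHomsExtend (Block n (λ a b → not ⌊ a ≟ b ⌋))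
complete-partialHomsExtend n Q τ τ-hom with extend-injection Q τ τ-injective
  where
  τ-injective : ∀ {a b} → T (Q a) → T (Q b) → τ a ≡ τ b → a ≡ b
  τ-injective {a} {b} Qa Qb τa≡τb with a ≟ b
  ... | yes a≡b = a≡b
  ... | no a≢b = contradiction τa≡τb (toWitnessFalse (τ-hom a b Qa Qb (fromWitnessFalse a≢b)))
... | σ , σ-injective , σ-agrees =
  σ , (λ a b a≢b → fromWitnessFalse (toWitnessFalse a≢b ∘ σ-injective)) , σ-agrees

rotate : Fin 3 → Fin 3 → Fin 3 → Fin 3
rotate a₀ b₀ a with a ≟ a₀ | a ≟ next3 a₀
... | yes _ | _ = b₀
... | no _ | yes _ = next3 b₀
... | no _ | no _ = next3 (next3 b₀)

rotate-base : ∀ a₀ b₀ → rotate a₀ b₀ a₀ ≡ b₀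
rotate-base = toWitness {a? = all? λ a₀ → all? λ b₀ → rotate a₀ b₀ a₀ ≟ b₀} tt

rotate-next3 : ∀ a₀ b₀ a → rotate a₀ b₀ (next3 a) ≡ next3 (rotate a₀ b₀ a)
rotate-next3 = toWitness
  {a? = all? λ a₀ → all? λ b₀ → all? λ a → rotate a₀ b₀ (next3 a) ≟ next3 (rotate a₀ b₀ a)} tt

cycle-partialHomsExtend : PartialHomsExtend (Block 3 (λ a b → ⌊ b ≟ next3 a ⌋))
cycle-partialHomsExtend Q τ τ-hom with any? (λ a → T? (Q a))
... | no untouched = id , (λ _ _ → id) , λ a Qa → contradiction (a , Qa) untouched
... | yes (a₀ , Qa₀) = rotate a₀ (τ a₀) , rotate-hom , agrees
  where
  successor : ∀ {a b} → T (Q a) → T (Q b) → b ≡ next3 a → τ b ≡ next3 (τ a)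
  successor Qa Qb b≡a+1 = toWitness (τ-hom _ _ Qa Qb (fromWitness b≡a+1))
  rotate-hom : ∀ a b → T ⌊ b ≟ next3 a ⌋ → T ⌊ rotate a₀ (τ a₀) b ≟ next3 (rotate a₀ (τ a₀) a) ⌋
  rotate-hom a b b≡a+1 =
    fromWitness (trans (cong (rotate a₀ (τ a₀)) (toWitness b≡a+1)) (rotate-next3 a₀ (τ a₀) a))
  agrees : ∀ a → T (Q a) → rotate a₀ (τ a₀) a ≡ τ a
  agrees a Qa with next3-trichotomy a₀ a
  ... | inj₁ a₀≡a = begin
    rotate a₀ (τ a₀) a            ≡⟨ cong (rotate a₀ (τ a₀)) a₀≡a ⟨
    rotate a₀ (τ a₀) a₀           ≡⟨ rotate-base a₀ (τ a₀) ⟩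
    τ a₀                          ≡⟨ cong τ a₀≡a ⟩
    τ a                           ∎
    where open ≡-Reasoning
  ... | inj₂ (inj₁ a≡a₀+1) = begin
    rotate a₀ (τ a₀) a            ≡⟨ cong (rotate a₀ (τ a₀)) a≡a₀+1 ⟩
    rotate a₀ (τ a₀) (next3 a₀)   ≡⟨ rotate-next3 a₀ (τ a₀) a₀ ⟩
    next3 (rotate a₀ (τ a₀) a₀)   ≡⟨ cong next3 (rotate-base a₀ (τ a₀)) ⟩
    next3 (τ a₀)                  ≡⟨ successor Qa₀ Qa a≡a₀+1 ⟨
    τ a                           ∎
    where open ≡-Reasoning
  ... | inj₂ (inj₂ a₀≡a+1) = next3-injective (begin
    next3 (rotate a₀ (τ a₀) a)    ≡⟨ rotate-next3 a₀ (τ a₀) a ⟨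
    rotate a₀ (τ a₀) (next3 a)    ≡⟨ cong (rotate a₀ (τ a₀)) a₀≡a+1 ⟨
    rotate a₀ (τ a₀) a₀           ≡⟨ rotate-base a₀ (τ a₀) ⟩
    τ a₀                          ≡⟨ successor Qa Qa₀ a₀≡a+1 ⟩
    next3 (τ a)                   ∎)
    where open ≡-Reasoning

module _ {m : ℕ} (E : Fin m → Fin m → Bool) (irr : Irreflexive (mkFin m E)) where

  DisjointCliques DisjointCycles : Set
  DisjointCliques = Σ ℕ λ k → Σ ℕ λ n → k ≥ 1 × n ≥ 1 × (mkFin m E ≅ kK k n)
  DisjointCycles = Σ ℕ λ k → k ≥ 1 × (mkFin m E ≅ kC3 k)

  cliques : ∀ {n} → Blocks E n (λ a b → not ⌊ a ≟ b ⌋) → n ≥ 1 → Fin m → DisjointCliques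
  cliques B n≥1 x₀ = proj₁ iso , _ , proj₁ (proj₂ iso) , n≥1 , proj₂ (proj₂ iso)
    where iso = blocks⇒≅ B x₀

  homHomogeneous⇒classified : Fin m → HomHomogeneous m E → DisjointCliques ⊎ DisjointCycles
  homHomogeneous⇒classified x₀ hh with any? (λ x → any? (λ y → T? (E x y) ×-dec T? (E y x)))
  ... | yes (a , b , a⟶b , b⟶a) =
    inj₁ (cliques (SymmetricClassification.blocks E irr hh a⟶b b⟶a) (s≤s z≤n) a)
  ... | no no-2-cycle with any? (λ x → any? (λ y → T? (E x y)))
  ...   | yes (a , b , a⟶b) = inj₂ (blocks⇒≅ (OrientedClassification.blocks E irr asym hh a⟶b) a)
    where
    asym : ∀ {x y} → T (E x y) → ¬ T (E y x)
    asym {x} {y} x⟶y y⟶x = no-2-cycle (x , y , x⟶y , y⟶x)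
  ...   | no no-edge =
    inj₁ (cliques (edgeless-blocks E irr λ x y x⟶y → no-edge (x , y , x⟶y)) (s≤s z≤n) x₀)

  classified⇒homHomogeneous : DisjointCliques ⊎ DisjointCycles → HomHomogeneous m E
  classified⇒homHomogeneous (inj₁ (k , n , _ , _ , D≅)) = partialHomsExtend⇒homHomogeneous m E
    (partialHomsExtend-≅ D≅
      (blockDigraph-partialHomsExtend _ complete-connected (complete-partialHomsExtend n) k))
    where
    complete-connected : ∀ a b → a ≢ b → T (not ⌊ a ≟ b ⌋) ⊎ T (not ⌊ b ≟ a ⌋)
    complete-connected a b a≢b = inj₁ (fromWitnessFalse a≢b)
  classified⇒homHomogeneous (inj₂ (k , _ , D≅)) = partialHomsExtend⇒homHomogeneous m E
    (partialHomsExtend-≅ D≅ (blockDigraph-partialHomsExtend _ cycle-connected cycle-partialHomsExtend k))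
    where
    cycle-connected : ∀ a b → a ≢ b → T ⌊ b ≟ next3 a ⌋ ⊎ T ⌊ a ≟ next3 b ⌋
    cycle-connected a b a≢b with next3-trichotomy a b
    ... | inj₁ a≡b = contradiction a≡b a≢b
    ... | inj₂ (inj₁ b≡a+1) = inj₁ (fromWitness b≡a+1)
    ... | inj₂ (inj₂ a≡b+1) = inj₂ (fromWitness a≡b+1)

corollary3p4 : (m : ℕ) (E : Fin m → Fin m → Bool) → m ≥ 1 →
    Irreflexive (mkFin m E) →
    HomHomogeneous m E ⇔
      ((Σ ℕ λ k → Σ ℕ λ n → k ≥ 1 × n ≥ 1 × (mkFin m E ≅ kK k n))
       ⊎ (Σ ℕ λ k → k ≥ 1 × (mkFin m E ≅ kC3 k)))
corollary3p4 (suc m) E _ irr =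
  mk⇔ (homHomogeneous⇒classified E irr zero) (classified⇒homHomogeneous E irr)
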